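{- Let $\Psi\subset\Delta^+_\ell$ be a root ideal, $\mu\in\mathbb Z^\ell$ and $m\in[\ell]$. Then $$H(\Psi;\mu)=\sum_{z\in\mathrm{downpath}_\Psi(m)}t^{B_\Psi(m,z)}H(\Psi^z;\mu+\epsilon_m-\epsilon_z),$$ where $\Psi^z=\Psi\setminus\{(z,\mathrm{down}_\Psi(z))\}$ if $z$ is not the last element of $\mathrm{downpath}_\Psi(m)$, and $\Psi^z=\Psi$ if $z$ is the last element of $\mathrm{downpath}_\Psi(m)$.
   Context: For $\gamma\in\mathbb Z^\ell$, $s_\gamma=\det(h_{\gamma_i+j-i})_{1\le i,j\le\ell}$; $\epsilon_i$ standard basis vectors of $\mathbb Z^\ell$; $[\ell]=\{1,\dots,\ell\}$. $\Delta^+_\ell=\{(i,j):1\le i<j\le\ell\}$ with order $(a,b)\le(c,d)$ iff $a\ge c$ and $b\le d$; a root ideal is an upper order ideal; $\alpha\in\Psi$ is removable if $\Psi\setminus\{\alpha\}$ is a root ideal. $H(\Psi;\gamma)$ is obtained by expanding $\prod_{(i,j)\in\Psi}(1-tz_i/z_j)^{ -1}z^\gamma$ as a power series in $t$ and applying coefficientwise the linear map $z^\beta\mapsto s_\beta$. $\mathrm{down}_\Psi(x)=j$ if $(x,j)$ is a removable root of $\Psi$ (undefined otherwise). $\mathrm{downpath}_\Psi(m)=(m,\mathrm{down}_\Psi(m),\mathrm{down}^2_\Psi(m),\dots)$, continued as long as defined; for $z=\mathrm{down}^j_\Psi(m)$ in it, $B_\Psi(m,z)=j$. -}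

module Defs where

open import Level using (0ℓ)
open import Data.Bool using (Bool; true; false; _∧_; _∨_; not; if_then_else_)
open import Data.Nat using (ℕ; zero; suc; _∸_; _<ᵇ_; _≤ᵇ_)
open import Data.Integer as ℤ using (ℤ; +_; -[1+_])
open import Data.Fin using (Fin; toℕ; punchIn; _≟_)
open import Data.Fin.Base using () renaming (zero to fz)
open import Data.List using (List; []; _∷_; map; concatMap; foldr; length; allFin; upTo)
open import Data.Maybe using (Maybe; just; nothing)
open import Data.Product using (_×_; _,_)
open import Relation.Nullary using (does)
open import Algebra.Bundles using (CommutativeRing)

-- Positive roots, root ideals, removable roots, down, downpath
-- Indices [ℓ] = {1..ℓ} are represented by Fin ℓ (shifted by one).

RootSet : ℕ → Set
RootSet ℓ = Fin ℓ → Fin ℓ → Bool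

_==_ : ∀ {ℓ} → Fin ℓ → Fin ℓ → Bool
a == b = does (a ≟ b)

pairs : ∀ ℓ → List (Fin ℓ × Fin ℓ)
pairs ℓ = concatMap (λ i → map (λ j → (i , j)) (allFin ℓ)) (allFin ℓ)

allᵇ : ∀ {A : Set} → (A → Bool) → List A → Bool
allᵇ p = foldr (λ x b → p x ∧ b) true

-- Ψ ⊆ Δ⁺_ℓ  (every (i,j) ∈ Ψ has i < j)  and Ψ is an upper order ideal
-- for (a,b) ≤ (c,d) ⟺ a ≥ c and b ≤ d.
isRootIdealᵇ : ∀ {ℓ} → RootSet ℓ → Bool
isRootIdealᵇ {ℓ} Ψ =
  allᵇ (λ { (a , b) → not (Ψ a b) ∨ (toℕ a <ᵇ toℕ b) }) (pairs ℓ)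
  ∧ allᵇ (λ { (a , b) → allᵇ (λ { (c , d) →
        not (Ψ a b ∧ (toℕ c ≤ᵇ toℕ a) ∧ (toℕ b ≤ᵇ toℕ d)) ∨ Ψ c d }) (pairs ℓ) })
        (pairs ℓ)

IsRootIdeal : ∀ {ℓ} → RootSet ℓ → Set
IsRootIdeal Ψ = isRootIdealᵇ Ψ ≡ true
  where open import Relation.Binary.PropositionalEquality using (_≡_)

remove : ∀ {ℓ} → RootSet ℓ → Fin ℓ → Fin ℓ → RootSet ℓ
remove Ψ a b i j = Ψ i j ∧ not ((a == i) ∧ (b == j))

removableᵇ : ∀ {ℓ} → RootSet ℓ → Fin ℓ → Fin ℓ → Bool
removableᵇ Ψ a b = Ψ a b ∧ isRootIdealᵇ (remove Ψ a b)

findᵇ : ∀ {A : Set} → (A → Bool) → List A → Maybe A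
findᵇ p [] = nothing
findᵇ p (x ∷ xs) = if p x then just x else findᵇ p xs

-- down_Ψ(x) = j if (x,j) is a removable root of Ψ (such j is unique
-- when Ψ is a root ideal), undefined (nothing) otherwise.
down : ∀ {ℓ} → RootSet ℓ → Fin ℓ → Maybe (Fin ℓ)
down {ℓ} Ψ x = findᵇ (removableᵇ Ψ x) (allFin ℓ)

-- Walk along the downpath; each entry is (z , B_Ψ(m,z) , Ψ^z), where
-- Ψ^z = Ψ ∖ {(z, down z)} if z is not the last element, Ψ^z = Ψ if it is.
-- The fuel ℓ always suffices for root ideals (down strictly increases).
dp : ∀ {ℓ} → RootSet ℓ → ℕ → ℕ → Fin ℓ → List (Fin ℓ × ℕ × RootSet ℓ)
dp Ψ zero j x = (x , j , Ψ) ∷ []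
dp Ψ (suc f) j x with down Ψ x
... | nothing = (x , j , Ψ) ∷ []
... | just y  = (x , j , remove Ψ x y) ∷ dp Ψ f (suc j) y

downpath : ∀ {ℓ} → RootSet ℓ → Fin ℓ → List (Fin ℓ × ℕ × RootSet ℓ)
downpath {ℓ} Ψ m = dp Ψ ℓ 0 m

δ : ∀ {ℓ} → Fin ℓ → Fin ℓ → ℕ → ℤ
δ i k n = if i == k then + n else + 0

shift : ∀ {ℓ} → (Fin ℓ → ℤ) → Fin ℓ → Fin ℓ → ℕ → (Fin ℓ → ℤ)
shift γ i j n k = (γ k ℤ.+ δ i k n) ℤ.- δ j k n

plusEps : ∀ {ℓ} → (Fin ℓ → ℤ) → Fin ℓ → Fin ℓ → (Fin ℓ → ℤ)
plusEps μ m z = shift μ m z 1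

roots : ∀ {ℓ} → RootSet ℓ → List (Fin ℓ × Fin ℓ)
roots {ℓ} Ψ = foldr (λ { (i , j) r → if Ψ i j then (i , j) ∷ r else r }) [] (pairs ℓ)

comps : ℕ → ℕ → List (List ℕ)
comps zero zero = [] ∷ []
comps zero (suc k) = []
comps (suc r) k = concatMap (λ a → map (a ∷_) (comps r (k ∸ a))) (upTo (suc k))

applyComp : ∀ {ℓ} → (Fin ℓ → ℤ) → List (Fin ℓ × Fin ℓ) → List ℕ → (Fin ℓ → ℤ)
applyComp γ ((i , j) ∷ rs) (n ∷ ns) = applyComp (shift γ i j n) rs ns
applyComp γ _ _ = γ

-- Symmetric functions.  Λ = ℤ[h₁,h₂,…] is the free commutative ring on the
-- complete homogeneous functions; an identity holds in Λ iff it holds in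
-- every commutative ring R for every choice of values h₁,h₂,… ∈ R.
-- Here `h n` stands for h_{n+1}; h₀ = 1 and h_k = 0 for k < 0.

module Sym (R : CommutativeRing 0ℓ 0ℓ) (h : ℕ → CommutativeRing.Carrier R) where
  open CommutativeRing R

  hZ : ℤ → Carrier
  hZ (+ zero) = 1#
  hZ (+ suc n) = h n
  hZ -[1+ n ] = 0#

  sumL : List Carrier → Carrier
  sumL = foldr _+_ 0#

  sgn : ℕ → Carrier → Carrier
  sgn zero x = x
  sgn (suc n) x = - sgn n x

  det : ∀ {n} → (Fin n → Fin n → Carrier) → Carrier
  det {zero} M = 1#
  det {suc n} M = sumL (map (λ j → sgn (toℕ j) (M fz j * det (λ i k → M (Data.Fin.suc i) (punchIn j k)))) (allFin (suc n)))

  s : ∀ {ℓ} → (Fin ℓ → ℤ) → Carrier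
  s γ = det (λ i j → hZ ((γ i ℤ.+ + toℕ j) ℤ.- + toℕ i))

  -- coefficient of t^k in H(Ψ;γ)
  Hcoef : ∀ {ℓ} → RootSet ℓ → (Fin ℓ → ℤ) → ℕ → Carrier
  Hcoef Ψ γ k = sumL (map (λ c → s (applyComp γ (roots Ψ) c)) (comps (length (roots Ψ)) k))

  -- coefficient of t^k in Σ_{z ∈ downpath_Ψ(m)} t^{B_Ψ(m,z)} H(Ψ^z; μ+ε_m-ε_z)
  RHScoef : ∀ {ℓ} → RootSet ℓ → (Fin ℓ → ℤ) → Fin ℓ → ℕ → Carrier
  RHScoef Ψ μ m k = sumL (map (λ { (z , B , Ψz) →
      if B ≤ᵇ k then Hcoef Ψz (plusEps μ m z) (k ∸ B) else 0# }) (downpath Ψ m))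

-- Expanding (1 - t z_a/z_b)⁻¹ = 1 + t (z_a/z_b) (1 - t z_a/z_b)⁻¹ in one factor of H(Ψ;γ)
-- gives, for every root (a,b) ∈ Ψ, the deletion recurrence
--   H(Ψ;γ) = H(Ψ ∖ {(a,b)};γ) + t H(Ψ;γ + ε_a - ε_b).
-- Start with γ = μ = μ + ε_m - ε_m and apply it to the root (z, down z) for z = m, down m, …
-- along the downpath: the shifted argument μ + ε_m - ε_z + ε_z - ε_{down z} is again of the
-- form μ + ε_m - ε_{z'}, each step contributes one more power of t, and the walk stops at the
-- last element of the downpath, where Ψ is left intact.

module Submission where

open import Defs
open import Level using (0ℓ)
open import Data.Nat using (ℕ)
open import Data.Integer using (ℤ)
open import Data.Fin using (Fin)
open import Algebra.Bundles using (CommutativeRing)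

open import Data.Nat using (zero; suc; _∸_; _≤ᵇ_)
import Data.Integer as ℤ
open import Data.Integer.Solver using (module +-*-Solver)
open import Data.Fin using (toℕ; punchIn; _≟_)
open import Data.Bool using (Bool; true; false; _∧_; if_then_else_)
open import Data.Bool.Properties using (∧-identityʳ; ∧-zeroʳ)
open import Data.List using (List; []; _∷_; map; concatMap; foldr; length; allFin; upTo; applyUpTo; _++_; cartesianProduct)
open import Data.List.Properties using (map-cong; map-∘; map-++; map-upTo)
open import Data.List.Membership.Propositional using (_∈_; _∉_)
open import Data.List.Membership.Propositional.Properties using (∈-allFin; ∈-cartesianProduct⁺)
open import Data.List.Relation.Unary.Any using (here; there)
open import Data.List.Relation.Unary.All as All using ()
open import Data.List.Relation.Unary.AllPairs using (_∷_)
open import Data.List.Relation.Unary.Unique.Propositional using (Unique)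
open import Data.List.Relation.Unary.Unique.Propositional.Properties using (allFin⁺; cartesianProduct⁺)
open import Data.Maybe using (just; nothing)
open import Data.Product using (_×_; _,_; ∃₂)
open import Data.Empty using (⊥-elim)
open import Relation.Nullary using (yes; no)
open import Relation.Binary.PropositionalEquality
  using (_≡_; _≢_; _≗_; refl; sym; trans; cong; cong₂; subst; subst₂)

remove-≢ : ∀ {ℓ} (Ψ : RootSet ℓ) {a b i j : Fin ℓ} → (i , j) ≢ (a , b) → remove Ψ a b i j ≡ Ψ i j
remove-≢ Ψ {a} {b} {i} {j} ij≢ab with a ≟ i | b ≟ j
... | yes refl | yes refl = ⊥-elim (ij≢ab refl)
... | yes _    | no _     = ∧-identityʳ (Ψ i j)
... | no _     | _        = ∧-identityʳ (Ψ i j)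

remove-diag : ∀ {ℓ} (Ψ : RootSet ℓ) (a b : Fin ℓ) → remove Ψ a b a b ≡ false
remove-diag Ψ a b with a ≟ a | b ≟ b
... | yes _   | yes _   = ∧-zeroʳ (Ψ a b)
... | yes _   | no b≢b  = ⊥-elim (b≢b refl)
... | no a≢a  | _       = ⊥-elim (a≢a refl)

findᵇ-sound : ∀ {A : Set} (p : A → Bool) xs {y} → findᵇ p xs ≡ just y → p y ≡ true
findᵇ-sound p (x ∷ xs) eq with p x in px
findᵇ-sound p (x ∷ xs) refl | true = px
... | false = findᵇ-sound p xs eq

down⇒∈ : ∀ {ℓ} (Ψ : RootSet ℓ) {x y} → down Ψ x ≡ just y → Ψ x y ≡ true
down⇒∈ {ℓ} Ψ {x} eq = ∧-trueˡ (findᵇ-sound (removableᵇ Ψ x) (allFin ℓ) eq)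
  where
  ∧-trueˡ : ∀ {a b} → a ∧ b ≡ true → a ≡ true
  ∧-trueˡ {true} _ = refl

pairs≡cartesianProduct : ∀ ℓ → pairs ℓ ≡ cartesianProduct (allFin ℓ) (allFin ℓ)
pairs≡cartesianProduct ℓ = go (allFin ℓ)
  where
  go : ∀ xs → concatMap (λ i → map (λ j → (i , j)) (allFin ℓ)) xs ≡ cartesianProduct xs (allFin ℓ)
  go []       = refl
  go (x ∷ xs) = cong (map (x ,_) (allFin ℓ) ++_) (go xs)

pairs-unique : ∀ ℓ → Unique (pairs ℓ)
pairs-unique ℓ =
  subst Unique (sym (pairs≡cartesianProduct ℓ)) (cartesianProduct⁺ (allFin⁺ ℓ) (allFin⁺ ℓ))

∈-pairs : ∀ {ℓ} (a b : Fin ℓ) → (a , b) ∈ pairs ℓ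
∈-pairs {ℓ} a b =
  subst ((a , b) ∈_) (sym (pairs≡cartesianProduct ℓ)) (∈-cartesianProduct⁺ (∈-allFin a) (∈-allFin b))

rootsIn : ∀ {ℓ} → RootSet ℓ → List (Fin ℓ × Fin ℓ) → List (Fin ℓ × Fin ℓ)
rootsIn Ψ = foldr (λ { (i , j) r → if Ψ i j then (i , j) ∷ r else r }) []

rootsIn-remove-∷ : ∀ {ℓ} (Ψ : RootSet ℓ) {a b i j} L → (i , j) ≢ (a , b) →
  rootsIn (remove Ψ a b) ((i , j) ∷ L)
    ≡ (if Ψ i j then (i , j) ∷ rootsIn (remove Ψ a b) L else rootsIn (remove Ψ a b) L)
rootsIn-remove-∷ Ψ {a} {b} {i} {j} L ij≢ab =
  cong (λ c → if c then (i , j) ∷ rootsIn (remove Ψ a b) L else rootsIn (remove Ψ a b) L) (remove-≢ Ψ ij≢ab)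

rootsIn-remove-head : ∀ {ℓ} (Ψ : RootSet ℓ) a b L → rootsIn (remove Ψ a b) ((a , b) ∷ L) ≡ rootsIn (remove Ψ a b) L
rootsIn-remove-head Ψ a b L =
  cong (λ c → if c then (a , b) ∷ rootsIn (remove Ψ a b) L else rootsIn (remove Ψ a b) L) (remove-diag Ψ a b)

rootsIn-remove-∉ : ∀ {ℓ} (Ψ : RootSet ℓ) {a b} L → (a , b) ∉ L → rootsIn (remove Ψ a b) L ≡ rootsIn Ψ L
rootsIn-remove-∉ Ψ []            _    = refl
rootsIn-remove-∉ Ψ ((i , j) ∷ L) ab∉L =
  trans (rootsIn-remove-∷ Ψ L (λ ij≡ab → ab∉L (here (sym ij≡ab))))
        (cong (λ r → if Ψ i j then (i , j) ∷ r else r) (rootsIn-remove-∉ Ψ L (λ ab∈L → ab∉L (there ab∈L))))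

∷-if-split : ∀ {A : Set} (c : Bool) (p : A) {x X Y L M} → L ≡ X ++ x ∷ Y → M ≡ X ++ Y →
  ∃₂ λ X′ Y′ → (if c then p ∷ L else L) ≡ X′ ++ x ∷ Y′ × (if c then p ∷ M else M) ≡ X′ ++ Y′
∷-if-split true  p {X = X} {Y} L≡ M≡ = p ∷ X , Y , cong (p ∷_) L≡ , cong (p ∷_) M≡
∷-if-split false p {X = X} {Y} L≡ M≡ = X , Y , L≡ , M≡

rootsIn-remove : ∀ {ℓ} (Ψ : RootSet ℓ) {a b L} → Unique L → (a , b) ∈ L → Ψ a b ≡ true →
  ∃₂ λ X Y → rootsIn Ψ L ≡ X ++ (a , b) ∷ Y × rootsIn (remove Ψ a b) L ≡ X ++ Y
rootsIn-remove Ψ {a} {b} {_ ∷ L} (ab≢L ∷ _) (here refl) Ψab =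
  [] , rootsIn Ψ L ,
  cong (λ c → if c then (a , b) ∷ rootsIn Ψ L else rootsIn Ψ L) Ψab ,
  trans (rootsIn-remove-head Ψ a b L) (rootsIn-remove-∉ Ψ L (λ ab∈L → All.lookup ab≢L ab∈L refl))
rootsIn-remove Ψ {a} {b} {(i , j) ∷ L} (ij≢L ∷ L-unique) (there ab∈L) Ψab
  with rootsIn-remove Ψ L-unique ab∈L Ψab
... | X , Y , ΨL≡ , Ψ∖abL≡ with ∷-if-split (Ψ i j) (i , j) ΨL≡ Ψ∖abL≡
...   | X′ , Y′ , Ψ∷≡ , Ψ∖ab∷≡ =
  X′ , Y′ , Ψ∷≡ , trans (rootsIn-remove-∷ Ψ L (All.lookup ij≢L ab∈L)) Ψ∖ab∷≡

roots-remove : ∀ {ℓ} (Ψ : RootSet ℓ) {a b} → Ψ a b ≡ true →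
  ∃₂ λ X Y → roots Ψ ≡ X ++ (a , b) ∷ Y × roots (remove Ψ a b) ≡ X ++ Y
roots-remove {ℓ} Ψ {a} {b} = rootsIn-remove Ψ (pairs-unique ℓ) (∈-pairs a b)

module _ {ℓ : ℕ} where
  open +-*-Solver using (solve; _:+_; _:-_; _:=_; con)

  δ-zero : (i k : Fin ℓ) → δ i k 0 ≡ ℤ.+ 0
  δ-zero i k with i == k
  ... | true  = refl
  ... | false = refl

  δ-suc : (i k : Fin ℓ) (n : ℕ) → δ i k (suc n) ≡ δ i k 1 ℤ.+ δ i k n
  δ-suc i k n with i == k
  ... | true  = refl
  ... | false = refl

  shift-zero : ∀ (γ : Fin ℓ → ℤ) i j → shift γ i j 0 ≗ γ
  shift-zero γ i j k rewrite δ-zero i k | δ-zero j k =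
    solve 1 (λ g → (g :+ con (ℤ.+ 0)) :- con (ℤ.+ 0) := g) refl (γ k)

  shift-suc : ∀ (γ : Fin ℓ → ℤ) i j n → shift (shift γ i j 1) i j n ≗ shift γ i j (suc n)
  shift-suc γ i j n k rewrite δ-suc i k n | δ-suc j k n =
    solve 5 (λ g x₁ y₁ x y → ((g :+ x₁) :- y₁ :+ x) :- y := (g :+ (x₁ :+ x)) :- (y₁ :+ y))
      refl (γ k) (δ i k 1) (δ j k 1) (δ i k n) (δ j k n)

  shift-comm : ∀ (γ : Fin ℓ → ℤ) i j n a b m → shift (shift γ i j n) a b m ≗ shift (shift γ a b m) i j n
  shift-comm γ i j n a b m k =
    solve 5 (λ g x y u v → ((g :+ x) :- y :+ u) :- v := ((g :+ u) :- v :+ x) :- y)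
      refl (γ k) (δ i k n) (δ j k n) (δ a k m) (δ b k m)

  shift-cong : ∀ {γ γ′ : Fin ℓ → ℤ} i j n → γ ≗ γ′ → shift γ i j n ≗ shift γ′ i j n
  shift-cong i j n γ≗γ′ k = cong (λ v → (v ℤ.+ δ i k n) ℤ.- δ j k n) (γ≗γ′ k)

  shift-plusEps : ∀ (μ : Fin ℓ → ℤ) m x y → shift (plusEps μ m x) x y 1 ≗ plusEps μ m y
  shift-plusEps μ m x y k =
    solve 4 (λ g em ex ey → ((g :+ em) :- ex :+ ex) :- ey := (g :+ em) :- ey)
      refl (μ k) (δ m k 1) (δ x k 1) (δ y k 1)

  plusEps-diag : ∀ (μ : Fin ℓ → ℤ) m → μ ≗ plusEps μ m m
  plusEps-diag μ m k = solve 2 (λ g e → g := (g :+ e) :- e) refl (μ k) (δ m k 1)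

  applyComp-cong : ∀ {γ γ′ : Fin ℓ → ℤ} rs c → γ ≗ γ′ → applyComp γ rs c ≗ applyComp γ′ rs c
  applyComp-cong []              c        γ≗γ′ = γ≗γ′
  applyComp-cong (_ ∷ _)         []       γ≗γ′ = γ≗γ′
  applyComp-cong ((i , j) ∷ rs)  (n ∷ ns) γ≗γ′ = applyComp-cong rs ns (shift-cong i j n γ≗γ′)

applyUpTo-cong : ∀ {A : Set} {f g : ℕ → A} → f ≗ g → ∀ n → applyUpTo f n ≡ applyUpTo g n
applyUpTo-cong {f = f} {g} f≗g n =
  trans (sym (map-upTo f n)) (trans (map-cong f≗g (upTo n)) (map-upTo g n))

module _ (R : CommutativeRing 0ℓ 0ℓ) (h : ℕ → CommutativeRing.Carrier R) where
  open CommutativeRing R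
    using (Carrier; _≈_; _+_; _*_; 0#; setoid; reflexive; +-cong; +-congˡ; +-congʳ; +-assoc;
           +-identityˡ; +-identityʳ; +-commutativeSemigroup)
    renaming (refl to ≈-refl; sym to ≈-sym; trans to ≈-trans)
  open Sym R h
  open import Algebra.Properties.CommutativeSemigroup +-commutativeSemigroup using (interchange)
  open import Relation.Binary.Reasoning.Setoid setoid

  det-cong : ∀ {n} (M N : Fin n → Fin n → Carrier) → (∀ i j → M i j ≡ N i j) → det M ≡ det N
  det-cong {zero}  M N M≡N = refl
  det-cong {suc n} M N M≡N = cong sumL (map-cong (λ j → cong (sgn (toℕ j))
    (cong₂ _*_ (M≡N Data.Fin.zero j) (det-cong _ _ (λ i k → M≡N (Data.Fin.suc i) (punchIn j k)))))
    (allFin (suc n)))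

  s-cong : ∀ {ℓ} {γ γ′ : Fin ℓ → ℤ} → γ ≗ γ′ → s γ ≡ s γ′
  s-cong γ≗γ′ = det-cong _ _ (λ i j → cong (λ v → hZ ((v ℤ.+ ℤ.+ toℕ j) ℤ.- ℤ.+ toℕ i)) (γ≗γ′ i))

  HcoefL : ∀ {ℓ} → List (Fin ℓ × Fin ℓ) → (Fin ℓ → ℤ) → ℕ → Carrier
  HcoefL rs γ k = sumL (map (λ c → s (applyComp γ rs c)) (comps (length rs) k))

  HcoefL-cong : ∀ {ℓ} rs {γ γ′ : Fin ℓ → ℤ} k → γ ≗ γ′ → HcoefL rs γ k ≡ HcoefL rs γ′ k
  HcoefL-cong rs k γ≗γ′ =
    cong sumL (map-cong (λ c → s-cong (applyComp-cong rs c γ≗γ′)) (comps (length rs) k))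

  sumL-++ : ∀ xs ys → sumL (xs ++ ys) ≈ sumL xs + sumL ys
  sumL-++ []       ys = ≈-sym (+-identityˡ _)
  sumL-++ (x ∷ xs) ys = ≈-trans (+-congˡ (sumL-++ xs ys)) (≈-sym (+-assoc _ _ _))

  sumL-concatMap : ∀ {A B : Set} (f : B → Carrier) (g : A → List B) xs →
    sumL (map f (concatMap g xs)) ≈ sumL (map (λ x → sumL (map f (g x))) xs)
  sumL-concatMap f g []       = ≈-refl
  sumL-concatMap f g (x ∷ xs) = begin
    sumL (map f (g x ++ concatMap g xs))              ≡⟨ cong sumL (map-++ f (g x) (concatMap g xs)) ⟩
    sumL (map f (g x) ++ map f (concatMap g xs))      ≈⟨ sumL-++ (map f (g x)) _ ⟩
    sumL (map f (g x)) + sumL (map f (concatMap g xs)) ≈⟨ +-congˡ (sumL-concatMap f g xs) ⟩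
    sumL (map (λ x → sumL (map f (g x))) (x ∷ xs))    ∎

  HcoefL-∷ : ∀ {ℓ} (i j : Fin ℓ) rs γ K →
    HcoefL ((i , j) ∷ rs) γ K ≈ sumL (applyUpTo (λ c → HcoefL rs (shift γ i j c) (K ∸ c)) (suc K))
  HcoefL-∷ i j rs γ K = begin
    HcoefL ((i , j) ∷ rs) γ K
      ≈⟨ sumL-concatMap φ (λ c → map (c ∷_) (comps (length rs) (K ∸ c))) (upTo (suc K)) ⟩
    sumL (map (λ c → sumL (map φ (map (c ∷_) (comps (length rs) (K ∸ c))))) (upTo (suc K)))
      ≡⟨ cong sumL (map-cong (λ c → cong sumL (sym (map-∘ (comps (length rs) (K ∸ c))))) (upTo (suc K))) ⟩
    sumL (map (λ c → HcoefL rs (shift γ i j c) (K ∸ c)) (upTo (suc K)))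
      ≡⟨ cong sumL (map-upTo _ (suc K)) ⟩
    sumL (applyUpTo (λ c → HcoefL rs (shift γ i j c) (K ∸ c)) (suc K)) ∎
    where
    φ : List ℕ → Carrier
    φ c = s (applyComp γ ((i , j) ∷ rs) c)

  t· : (ℕ → Carrier) → ℕ → Carrier
  t· f zero    = 0#
  t· f (suc k) = f k

  t·-cong : ∀ {f g : ℕ → Carrier} → (∀ n → f n ≈ g n) → ∀ k → t· f k ≈ t· g k
  t·-cong f≈g zero    = ≈-refl
  t·-cong f≈g (suc k) = f≈g k

  DeletionRecurrence : ∀ {ℓ} → List (Fin ℓ × Fin ℓ) → List (Fin ℓ × Fin ℓ) → Fin ℓ → Fin ℓ → Set
  DeletionRecurrence X Y a b = ∀ γ k → HcoefL X γ k ≈ HcoefL Y γ k + t· (HcoefL X (shift γ a b 1)) k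

  deletion-head : ∀ {ℓ} (a b : Fin ℓ) X → DeletionRecurrence ((a , b) ∷ X) X a b
  deletion-head a b X γ zero =
    ≈-trans (HcoefL-∷ a b X γ 0) (+-congʳ (reflexive (HcoefL-cong X 0 (shift-zero γ a b))))
  deletion-head a b X γ (suc k) = begin
    HcoefL ((a , b) ∷ X) γ (suc k)
      ≈⟨ HcoefL-∷ a b X γ (suc k) ⟩
    HcoefL X (shift γ a b 0) (suc k) + sumL (applyUpTo (λ c → HcoefL X (shift γ a b (suc c)) (k ∸ c)) (suc k))
      ≡⟨ cong₂ _+_ (HcoefL-cong X (suc k) (shift-zero γ a b))
                   (cong sumL (applyUpTo-cong (λ c → HcoefL-cong X (k ∸ c) (λ i → sym (shift-suc γ a b c i))) (suc k))) ⟩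
    HcoefL X γ (suc k) + sumL (applyUpTo (λ c → HcoefL X (shift (shift γ a b 1) a b c) (k ∸ c)) (suc k))
      ≈⟨ +-congˡ (≈-sym (HcoefL-∷ a b X (shift γ a b 1) k)) ⟩
    HcoefL X γ (suc k) + HcoefL ((a , b) ∷ X) (shift γ a b 1) k ∎

  deletion-∷ : ∀ {ℓ} (i j : Fin ℓ) {X Y a b} → DeletionRecurrence X Y a b →
    DeletionRecurrence ((i , j) ∷ X) ((i , j) ∷ Y) a b
  deletion-∷ i j {X} {Y} {a} {b} rec = go
    where
    -- Peel (i , j) off both sides with deletion-head; its t-term is handled by go one degree lower.
    go : DeletionRecurrence ((i , j) ∷ X) ((i , j) ∷ Y) a b
    go γ zero = begin
      HcoefL ((i , j) ∷ X) γ 0    ≈⟨ deletion-head i j X γ 0 ⟩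
      HcoefL X γ 0 + 0#           ≈⟨ +-congʳ (rec γ 0) ⟩
      (HcoefL Y γ 0 + 0#) + 0#    ≈⟨ +-congʳ (deletion-head i j Y γ 0) ⟨
      HcoefL ((i , j) ∷ Y) γ 0 + 0# ∎
    go γ (suc k) = begin
      HcoefL ((i , j) ∷ X) γ (suc k)
        ≈⟨ deletion-head i j X γ (suc k) ⟩
      HcoefL X γ (suc k) + HcoefL ((i , j) ∷ X) γ-ij k
        ≈⟨ +-cong (rec γ (suc k)) (go γ-ij k) ⟩
      (HcoefL Y γ (suc k) + HcoefL X γ-ab k) +
      (HcoefL ((i , j) ∷ Y) γ-ij k + t· (HcoefL ((i , j) ∷ X) (shift γ-ij a b 1)) k)
        ≈⟨ interchange _ _ _ _ ⟩
      (HcoefL Y γ (suc k) + HcoefL ((i , j) ∷ Y) γ-ij k) +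
      (HcoefL X γ-ab k + t· (HcoefL ((i , j) ∷ X) (shift γ-ij a b 1)) k)
        ≈⟨ +-cong (deletion-head i j Y γ (suc k))
                  (+-congˡ (t·-cong (λ n → reflexive (HcoefL-cong ((i , j) ∷ X) n (shift-comm γ a b 1 i j 1))) k)) ⟨
      HcoefL ((i , j) ∷ Y) γ (suc k) +
      (HcoefL X γ-ab k + t· (HcoefL ((i , j) ∷ X) (shift γ-ab i j 1)) k)
        ≈⟨ +-congˡ (deletion-head i j X γ-ab k) ⟨
      HcoefL ((i , j) ∷ Y) γ (suc k) + HcoefL ((i , j) ∷ X) γ-ab k ∎
      where
      γ-ij γ-ab : Fin _ → ℤ
      γ-ij = shift γ i j 1
      γ-ab = shift γ a b 1

  deletion-++ : ∀ {ℓ} X Y (a b : Fin ℓ) → DeletionRecurrence (X ++ (a , b) ∷ Y) (X ++ Y) a b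
  deletion-++ []            Y a b = deletion-head a b Y
  deletion-++ ((i , j) ∷ X) Y a b = deletion-∷ i j {X ++ (a , b) ∷ Y} {X ++ Y} {a} {b} (deletion-++ X Y a b)

  Hcoef-remove : ∀ {ℓ} (Ψ : RootSet ℓ) {a b} → Ψ a b ≡ true →
    DeletionRecurrence (roots Ψ) (roots (remove Ψ a b)) a b
  Hcoef-remove Ψ {a} {b} Ψab with roots-remove Ψ Ψab
  ... | X , Y , Ψ≡ , Ψ∖ab≡ =
    subst₂ (λ X′ Y′ → DeletionRecurrence X′ Y′ a b) (sym Ψ≡) (sym Ψ∖ab≡) (deletion-++ X Y a b)

  module _ {ℓ} (Ψ : RootSet ℓ) (μ : Fin ℓ → ℤ) (m : Fin ℓ) where

    term : ℕ → Fin ℓ × ℕ × RootSet ℓ → Carrier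
    term n (z , B , Ψz) = if B ≤ᵇ n then Hcoef Ψz (plusEps μ m z) (n ∸ B) else 0#

    -- Split on j: suc j ≤ᵇ suc n only reduces to j ≤ᵇ n once j is a constructor.
    term-delay : ∀ n z j Ψz → term (suc n) (z , suc j , Ψz) ≡ term n (z , j , Ψz)
    term-delay n z zero    Ψz = refl
    term-delay n z (suc j) Ψz = refl

    -- RHScoef Ψ μ m is pathSum ℓ 0 m; j is the exponent B_Ψ(m, x) of the first entry x.
    pathSum : ℕ → ℕ → Fin ℓ → ℕ → Carrier
    pathSum fuel j x n = sumL (map (term n) (dp Ψ fuel j x))

    pathSum-zero : ∀ fuel j x → pathSum fuel (suc j) x 0 ≈ 0#
    pathSum-zero zero j x = +-identityʳ 0#
    pathSum-zero (suc fuel) j x with down Ψ x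
    ... | nothing = +-identityʳ 0#
    ... | just y  = ≈-trans (+-identityˡ _) (pathSum-zero fuel (suc j) y)

    pathSum-suc : ∀ fuel j x n → pathSum fuel (suc j) x (suc n) ≡ pathSum fuel j x n
    pathSum-suc zero j x n = cong (_+ 0#) (term-delay n x j Ψ)
    pathSum-suc (suc fuel) j x n with down Ψ x
    ... | nothing = cong (_+ 0#) (term-delay n x j Ψ)
    ... | just y  = cong₂ _+_ (term-delay n x j (remove Ψ x y)) (pathSum-suc fuel (suc j) y n)

    pathSum-delay : ∀ fuel j x n → pathSum fuel (suc j) x n ≈ t· (pathSum fuel j x) n
    pathSum-delay fuel j x zero    = pathSum-zero fuel j x
    pathSum-delay fuel j x (suc n) = reflexive (pathSum-suc fuel j x n)

    Hcoef-pathSum : ∀ fuel x k → Hcoef Ψ (plusEps μ m x) k ≈ pathSum fuel 0 x k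
    Hcoef-pathSum zero x k = ≈-sym (+-identityʳ _)
    Hcoef-pathSum (suc fuel) x k with down Ψ x in down-x
    ... | nothing = ≈-sym (+-identityʳ _)
    ... | just y  = begin
      Hcoef Ψ (plusEps μ m x) k
        ≈⟨ Hcoef-remove Ψ (down⇒∈ Ψ down-x) (plusEps μ m x) k ⟩
      Hcoef (remove Ψ x y) (plusEps μ m x) k + t· (Hcoef Ψ (shift (plusEps μ m x) x y 1)) k
        ≈⟨ +-congˡ (t·-cong (λ n → ≈-trans (reflexive (HcoefL-cong (roots Ψ) n (shift-plusEps μ m x y)))
                                            (Hcoef-pathSum fuel y n)) k) ⟩
      Hcoef (remove Ψ x y) (plusEps μ m x) k + t· (pathSum fuel 0 y) k
        ≈⟨ +-congˡ (pathSum-delay fuel 0 y k) ⟨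
      Hcoef (remove Ψ x y) (plusEps μ m x) k + pathSum fuel 1 y k ∎

  Hcoef≈RHScoef : ∀ {ℓ} (Ψ : RootSet ℓ) μ m k → Hcoef Ψ μ k ≈ RHScoef Ψ μ m k
  Hcoef≈RHScoef {ℓ} Ψ μ m k =
    ≈-trans (reflexive (HcoefL-cong (roots Ψ) k (plusEps-diag μ m))) (Hcoef-pathSum Ψ μ m ℓ m k)

corollary5p7 : (R : CommutativeRing 0ℓ 0ℓ) (h : ℕ → CommutativeRing.Carrier R)
    (ℓ : ℕ) (Ψ : RootSet ℓ) → IsRootIdeal Ψ → (μ : Fin ℓ → ℤ) (m : Fin ℓ) (k : ℕ) →
    CommutativeRing._≈_ R (Sym.Hcoef R h Ψ μ k) (Sym.RHScoef R h Ψ μ m k)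
corollary5p7 R h ℓ Ψ _ μ m k = Hcoef≈RHScoef R h Ψ μ m k
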